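{- Let $m$ be a power of $2$, $d=\log m$, and $w_i=m/2^i$. For each $0\le i<d$, let $(S_{(i+1)j})_{j=1}^{w_{i+1}}$ be a family of subsets of $[w_i]$ satisfying: (1) for every $x\in\{0,1\}^{w_i}$, $\Pr_j[|\overline{x|_{S_{(i+1)j}}}-\overline{x}|>1/10]\le 6/10$; (2) for all $\eta<1/10$ and every $x\in\{0,1\}^{w_i}$ with $\overline{x}\ge1-\eta$, $\Pr_j[\overline{x|_{S_{(i+1)j}}}<8/10]\le\eta/2$; (3) all sets have the same constant size (here $j$ is uniform in $[w_{i+1}]$). Let layer $i+1$ of the circuit consist of gates $L_{(i+1)j}=\mathrm{Thr}_{0.8}$ applied to the bits of layer $i$ indexed by $S_{(i+1)j}$, and for $y\in\{0,1\}^{w_i}$ let $L_{i+1}(y)\in\{0,1\}^{w_{i+1}}$ be the vector of outputs of these gates on input $y$. If $y_i\in\{0,1\}^{w_i}$ satisfies $\overline{y_i}\le 7/10$ and $y_{i+1}=L_{i+1}(y_i)$, then $\overline{y_{i+1}}\le 6/10$.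
   Context: For a bit string $x$, $\overline{x}$ denotes its fraction of ones, and $\overline{x|_S}$ is the average of $x$ over positions in $S$. $\mathrm{Thr}_{\delta}$ applied to a collection of bits outputs $1$ iff at least a $\delta$-fraction of them are $1$. -}

module Defs where

open import Data.Bool using (Bool; true; false; not)
open import Data.Nat as ℕ using (ℕ; zero; suc; _∸_; _^_)
open import Data.Integer using (+_)
open import Data.Rational using (ℚ; _/_; 0ℚ; _≤ᵇ_; _*_)
open import Data.Fin using (Fin)
open import Data.Vec using (Vec; tabulate; lookup)
open import Data.Fin.Subset using (Subset; _∩_; ∣_∣)

-- Bit strings of length n are Vec Bool n; subsets of [n] are Subset n
-- (also Vec Bool n, true = inside).

_<ᵇ_ : ℚ → ℚ → Bool
p <ᵇ q = not (q ≤ᵇ p)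

-- a / b as a rational, with the (irrelevant here) convention a / 0 = 0
ratio : ℕ → ℕ → ℚ
ratio a zero = 0ℚ
ratio a (suc b) = + a / suc b

ones : ∀ {n} → Vec Bool n → ℕ
ones x = ∣ x ∣

frac : ∀ {n} → Vec Bool n → ℚ
frac {n} x = ratio (ones x) n

avgOn : ∀ {n} → Subset n → Vec Bool n → ℚ
avgOn S x = ratio ∣ S ∩ x ∣ ∣ S ∣

prob : ∀ {k} → (Fin k → Bool) → ℚ
prob {k} E = ratio (ones (tabulate E)) k

thr : ∀ {n} → ℚ → Subset n → Vec Bool n → Bool
thr δ S x = (δ * (+ ∣ S ∣ / 1)) ≤ᵇ (+ ∣ S ∩ x ∣ / 1)

layer : ∀ {n k} → (Fin k → Subset n) → Vec Bool n → Vec Bool k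
layer S y = tabulate (λ j → thr (+ 8 / 10) (S j) y)

-- w_i = m / 2^i = 2^(d - i) where m = 2^d  (valid for i ≤ d)
w : ℕ → ℕ → ℕ
w d i = 2 ^ (d ∸ i)

-- A gate fires only if at least 8/10 of the bits it reads are ones, whereas the density of y
-- is strictly below 7/10: it cannot equal 7/10 because its length is a power of two. So every
-- firing gate reads a set on which y deviates from its mean by more than 1/10, and condition
-- (1) bounds the fraction of such gates by 6/10. This needs every set to be nonempty (Thr
-- fires vacuously on the empty set); condition (2) at the all-ones input with η = 0 gives
-- that.
module Submission where

open import Defs
open import Data.Bool using (Bool; true; false; T)
open import Data.Bool.Properties using (T-≡)
open import Data.Fin using (Fin; toℕ)
open import Data.Fin.Subset using (Subset; _∩_; _∈_; _⊆_; ⁅_⁆; ⊤) renaming (∣_∣ to size)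
open import Data.Fin.Subset.Properties using (p⊆q⇒∣p∣≤∣q∣; x∈⁅y⁆⇒x≡y; ∣⁅x⁆∣≡1; ∣⊤∣≡n)
open import Data.Integer as ℤ using (+_)
import Data.Integer.Properties as ℤ
open import Data.Nat as ℕ using (ℕ; zero; suc; NonZero)
open import Data.Nat.Coprimality using (coprime?; coprime-divisor)
open import Data.Nat.Divisibility using (_∣_; _∣?_; divides)
import Data.Nat.Properties as ℕ
open import Algebra.Properties.CommutativeSemigroup ℕ.*-commutativeSemigroup using (x∙yz≈y∙xz)
open import Data.Product using (∃)
open import Data.Rational using (ℚ; _/_; _≤_; _<_; _-_; _*_; ∣_∣; 0ℚ; 1ℚ; ½; _≤ᵇ_; toℚᵘ; positive)
open import Data.Rational.Properties
open import Data.Rational.Unnormalised as ℚᵘ using (mkℚᵘ; *≡*)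
import Data.Rational.Unnormalised.Properties as ℚᵘ
open import Data.Vec using (Vec; tabulate)
open import Data.Vec.Properties using (lookup∘tabulate; lookup⇒[]=; []=⇒lookup)
open import Function using (_∘_; Equivalence)
open import Relation.Binary.PropositionalEquality
open import Relation.Nullary using (¬_; contradiction)
open import Relation.Nullary.Decidable using (from-yes; from-no)

open Equivalence using (to; from)

ratio≃mkℚᵘ : ∀ a c → toℚᵘ (ratio a (suc c)) ℚᵘ.≃ mkℚᵘ (+ a) c
ratio≃mkℚᵘ a c = toℚᵘ-fromℚᵘ (mkℚᵘ (+ a) c)

ratio-≤⁺ : ∀ a b c d → a ℕ.* suc d ℕ.≤ b ℕ.* suc c → ratio a (suc c) ≤ ratio b (suc d)
ratio-≤⁺ a b c d ad≤bc = toℚᵘ-cancel-≤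
  (ℚᵘ.≤-respˡ-≃ (ℚᵘ.≃-sym (ratio≃mkℚᵘ a c)) (ℚᵘ.≤-respʳ-≃ (ℚᵘ.≃-sym (ratio≃mkℚᵘ b d))
    (ℚᵘ.*≤* (subst₂ ℤ._≤_ (ℤ.pos-* a (suc d)) (ℤ.pos-* b (suc c)) (ℤ.+≤+ ad≤bc)))))

ratio-≤⁻ : ∀ a b c d → ratio a (suc c) ≤ ratio b (suc d) → a ℕ.* suc d ℕ.≤ b ℕ.* suc c
ratio-≤⁻ a b c d r≤r = ℤ.drop‿+≤+ (subst₂ ℤ._≤_ (sym (ℤ.pos-* a (suc d))) (sym (ℤ.pos-* b (suc c)))
  (ℚᵘ.drop-*≤* (ℚᵘ.≤-respˡ-≃ (ratio≃mkℚᵘ a c) (ℚᵘ.≤-respʳ-≃ (ratio≃mkℚᵘ b d) (toℚᵘ-mono-≤ r≤r)))))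

ratio-<⁺ : ∀ a b c d → a ℕ.* suc d ℕ.< b ℕ.* suc c → ratio a (suc c) < ratio b (suc d)
ratio-<⁺ a b c d ad<bc = toℚᵘ-cancel-<
  (ℚᵘ.<-respˡ-≃ (ℚᵘ.≃-sym (ratio≃mkℚᵘ a c)) (ℚᵘ.<-respʳ-≃ (ℚᵘ.≃-sym (ratio≃mkℚᵘ b d))
    (ℚᵘ.*<* (subst₂ ℤ._<_ (ℤ.pos-* a (suc d)) (ℤ.pos-* b (suc c)) (ℤ.+<+ ad<bc)))))

ratio-*-cancel : ∀ a s → ratio a (suc s) * ratio (suc s) 1 ≡ ratio a 1
ratio-*-cancel a s = toℚᵘ-injective (begin-equality
  toℚᵘ (ratio a (suc s) * ratio (suc s) 1)           ≃⟨ toℚᵘ-homo-* (ratio a (suc s)) (ratio (suc s) 1) ⟩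
  toℚᵘ (ratio a (suc s)) ℚᵘ.* toℚᵘ (ratio (suc s) 1) ≃⟨ ℚᵘ.*-cong (ratio≃mkℚᵘ a s) (ratio≃mkℚᵘ (suc s) 0) ⟩
  mkℚᵘ (+ a) s ℚᵘ.* mkℚᵘ (+ suc s) 0                  ≃⟨ *≡* (ℤ.*-assoc (+ a) (+ suc s) (+ 1)) ⟩
  mkℚᵘ (+ a) 0                                         ≃⟨ ℚᵘ.≃-sym (ratio≃mkℚᵘ a 0) ⟩
  toℚᵘ (ratio a 1)                                     ∎)
  where open ℚᵘ.≤-Reasoning

a≤p∧q<b⇒a-b<∣p-q∣ : ∀ {a b p q} → 0ℚ ≤ a - b → a ≤ p → q < b → a - b < ∣ p - q ∣
a≤p∧q<b⇒a-b<∣p-q∣ {a} {b} {p} {q} 0≤a-b a≤p q<b =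
  subst (a - b <_) (sym (0≤p⇒∣p∣≡p (≤-trans 0≤a-b (<⇒≤ a-b<p-q)))) a-b<p-q
  where
  a-b<p-q : a - b < p - q
  a-b<p-q = +-mono-≤-< a≤p (neg-antimono-< q<b)

<⇒<ᵇ : ∀ {p q} → p < q → T (p <ᵇ q)
<⇒<ᵇ {p} {q} p<q with q ≤ᵇ p in q≤ᵇp
... | false = _
... | true  = <-irrefl refl (<-≤-trans p<q (≤ᵇ⇒≤ (subst T (sym q≤ᵇp) _)))

thr⇒≤avgOn : ∀ δ {n} (S : Subset n) x → size S ≢ 0 → T (thr δ S x) → δ ≤ avgOn S x
thr⇒≤avgOn δ S x S≢∅ fires with size S
... | zero  = contradiction refl S≢∅
... | suc s = *-cancelʳ-≤-pos (ratio (suc s) 1) {{positive (ratio-<⁺ 0 (suc s) 0 0 ℕ.z<s)}}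
  (subst (δ * ratio (suc s) 1 ≤_) (sym (ratio-*-cancel (size (S ∩ x)) s)) (≤ᵇ⇒≤ fires))

avgOn-∅ : ∀ {n} (S : Subset n) x → size S ≡ 0 → avgOn S x ≡ 0ℚ
avgOn-∅ S x ∣S∣≡0 rewrite ∣S∣≡0 = refl

frac-<-unattained : ∀ {n} (y : Vec Bool n) b c → (∀ o → o ℕ.* suc c ≢ b ℕ.* n)
  → frac y ≤ ratio b (suc c) → frac y < ratio b (suc c)
frac-<-unattained {zero}  y b c unattained _   = contradiction (sym (ℕ.*-zeroʳ b)) (unattained 0)
frac-<-unattained {suc n} y b c unattained y≤ =
  ratio-<⁺ (ones y) b n c (ℕ.≤∧≢⇒< (ratio-≤⁻ (ones y) b n c y≤) (unattained (ones y)))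

1≤frac⊤ : ∀ n .{{_ : NonZero n}} → 1ℚ ≤ frac (⊤ {n})
1≤frac⊤ (suc n) = subst (λ k → 1ℚ ≤ ratio k (suc n)) (sym (∣⊤∣≡n (suc n)))
  (ratio-≤⁺ 1 (suc n) 0 n (ℕ.≤-reflexive (ℕ.*-comm 1 (suc n))))

5∤7*2^k : ∀ k → ¬ 5 ∣ 7 ℕ.* 2 ℕ.^ k
5∤7*2^k zero = from-no (5 ∣? 7)
5∤7*2^k (suc k) 5∣ = 5∤7*2^k k
  (coprime-divisor (from-yes (coprime? 5 2)) (subst (5 ∣_) (x∙yz≈y∙xz 7 2 (2 ℕ.^ k)) 5∣))

o*10≢7*2^k : ∀ k o → o ℕ.* 10 ≢ 7 ℕ.* 2 ℕ.^ k
o*10≢7*2^k k o eq = 5∤7*2^k k (divides (o ℕ.* 2) (trans (sym eq) (sym (ℕ.*-assoc o 2 5))))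

∈-tabulate⁺ : ∀ {k} {E : Fin k → Bool} {j} → T (E j) → j ∈ tabulate E
∈-tabulate⁺ {E = E} {j} Ej = lookup⇒[]= j (tabulate E) (trans (lookup∘tabulate E j) (to T-≡ Ej))

∈-tabulate⁻ : ∀ {k} {E : Fin k → Bool} {j} → j ∈ tabulate E → T (E j)
∈-tabulate⁻ {E = E} {j} j∈ = from T-≡ (trans (sym (lookup∘tabulate E j)) ([]=⇒lookup j∈))

prob-mono : ∀ {k} {E F : Fin k → Bool} → (∀ j → T (E j) → T (F j)) → prob E ≤ prob F
prob-mono {zero}  E⇒F = ≤-refl
prob-mono {suc k} {E} {F} E⇒F = ratio-≤⁺ (ones (tabulate E)) (ones (tabulate F)) k k
  (ℕ.*-monoˡ-≤ (suc k) (p⊆q⇒∣p∣≤∣q∣ E⊆F))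
  where
  E⊆F : tabulate E ⊆ tabulate F
  E⊆F {j} = ∈-tabulate⁺ {E = F} ∘ E⇒F j ∘ ∈-tabulate⁻ {E = E}

prob≤0⇒never : ∀ {k} {E : Fin k → Bool} → prob E ≤ 0ℚ → ∀ j → ¬ T (E j)
prob≤0⇒never {suc k} {E} prob≤0 j Ej = ℕ.<⇒≱ 0<ones ones≤0
  where
  ones≤0 : ones (tabulate E) ℕ.* 1 ℕ.≤ 0
  ones≤0 = ratio-≤⁻ (ones (tabulate E)) 0 k 0 prob≤0
  ⁅j⁆⊆E : ⁅ j ⁆ ⊆ tabulate E
  ⁅j⁆⊆E i∈⁅j⁆ = subst (_∈ tabulate E) (sym (x∈⁅y⁆⇒x≡y j i∈⁅j⁆)) (∈-tabulate⁺ {E = E} Ej)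
  0<ones : 0 ℕ.< ones (tabulate E) ℕ.* 1
  0<ones = subst (0 ℕ.<_) (sym (ℕ.*-identityʳ (ones (tabulate E))))
    (subst (ℕ._≤ ones (tabulate E)) (∣⁅x⁆∣≡1 j) (p⊆q⇒∣p∣≤∣q∣ {p = ⁅ j ⁆} ⁅j⁆⊆E))

fires⇒deviates : ∀ {n} (S : Subset n) y → size S ≢ 0 → frac y < + 7 / 10
  → T (thr (+ 8 / 10) S y) → T ((+ 1 / 10) <ᵇ ∣ avgOn S y - frac y ∣)
fires⇒deviates S y S≢∅ y<7/10 fires =
  <⇒<ᵇ (a≤p∧q<b⇒a-b<∣p-q∣ (ratio-≤⁺ 0 1 0 9 ℕ.z≤n) (thr⇒≤avgOn (+ 8 / 10) S y S≢∅ fires) y<7/10)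

unanimous⇒nonempty : ∀ {n k} (S : Fin k → Subset n)
  → prob (λ j → avgOn (S j) ⊤ <ᵇ (+ 8 / 10)) ≤ 0ℚ → ∀ j → size (S j) ≢ 0
unanimous⇒nonempty S never j ∣Sj∣≡0 =
  prob≤0⇒never never j (subst (λ a → T (a <ᵇ (+ 8 / 10))) (sym (avgOn-∅ (S j) ⊤ ∣Sj∣≡0)) _)

lemma4 : (d : ℕ)
    → (S : (i : Fin d) → Fin (w d (suc (toℕ i))) → Subset (w d (toℕ i)))
    → (∀ (i : Fin d) (x : Vec Bool (w d (toℕ i)))
         → prob (λ j → (+ 1 / 10) <ᵇ ∣ avgOn (S i j) x - frac x ∣) ≤ + 6 / 10)
    → (∀ (i : Fin d) (η : ℚ) → η < + 1 / 10 → (x : Vec Bool (w d (toℕ i)))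
         → 1ℚ - η ≤ frac x
         → prob (λ j → avgOn (S i j) x <ᵇ (+ 8 / 10)) ≤ η * ½)
    → (∀ (i : Fin d) → ∃ λ c → ∀ j → size (S i j) ≡ c)
    → ∀ (i : Fin d) (y : Vec Bool (w d (toℕ i)))
    → frac y ≤ + 7 / 10
    → frac (layer (S i) y) ≤ + 6 / 10
lemma4 d S deviation unanimity _ i y y≤7/10 =
  ≤-trans (prob-mono (λ j → fires⇒deviates (S i j) y (nonempty j) y<7/10)) (deviation i y)
  where
  k : ℕ
  k = d ℕ.∸ toℕ i
  y<7/10 : frac y < + 7 / 10
  y<7/10 = frac-<-unattained y 7 9 (λ o → o*10≢7*2^k k o) y≤7/10
  nonempty : ∀ j → size (S i j) ≢ 0
  nonempty = unanimous⇒nonempty (S i)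
    (unanimity i 0ℚ (ratio-<⁺ 0 1 0 9 ℕ.z<s) ⊤ (1≤frac⊤ (2 ℕ.^ k) {{ℕ.m^n≢0 2 k}}))
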